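{- Let $c\geq 3$ be an integer. For $k=1,2,\dots$ let $I_k=[(k-1)c,kc)$ and let $\chi_{I_k}=1$ if $I_k$ contains at least one prime and $\chi_{I_k}=0$ otherwise. Then for all sufficiently large $m$, \[ \frac{1}{c}\pi(mc)\leq\sum_{k=1}^{m}\chi_{I_k}<\pi(mc); \] consequently, for fixed $c$, $\sum_{k=1}^{m}\chi_{I_k}\asymp \frac{m}{\ln m}$ as $m\to\infty$.
   Context: $\pi(x)$ denotes the number of primes $\leq x$. The notation $f(m)\asymp g(m)$ means that $f(m)/g(m)$ is bounded above and below by positive constants (which may depend on $c$) for all large $m$. -}

module Defs where

open import Data.Nat using (ℕ; zero; suc; _+_; _*_)
open import Data.List using (List; []; _∷_; length; filter; map; upTo)
open import Data.Nat.ListAction using (sum)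
open import Data.Nat.Primality using (prime?)

primeCount : ℕ → ℕ
primeCount x = length (filter prime? (upTo (suc x)))

primesIn : ℕ → ℕ → List ℕ
primesIn lo len = filter prime? (map (lo +_) (upTo len))

indicator : List ℕ → ℕ
indicator []      = 0
indicator (_ ∷ _) = 1

-- χ_{I_k} for I_k = [(k-1)c, kc), k ≥ 1; here written for k = suc j: I = [j c, j c + c)
χI : ℕ → ℕ → ℕ
χI c zero    = 0   -- k = 0 is never used
χI c (suc j) = indicator (primesIn (j * c) c)

S : ℕ → ℕ → ℕ
S c m = sum (map (λ j → χI c (suc j)) (upTo m))

module Submission where

-- 1. Block comparison.  The blocks I_1, …, I_m tile [0, mc), and a block holds between χ and c·χ
--    primes, so π(mc) ≤ c · S c m and S c m ≤ π(mc).  The defect π(mc) − S c m never decreases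
--    as blocks are added, and it becomes positive as soon as one block holds two primes, which
--    happens among the first two blocks when c ≥ 3.  For m ≥ 2 the number mc is composite.
-- 2. Chebyshev's bounds, with ⌊log₂⌋ in place of log.  Upper: the primes in (n, 2n] divide
--    C(2n, n) ≤ 4ⁿ, so (n+1)^{π(2n) − π(n)} ≤ 4ⁿ; summing over n = 2ᵏ gives π(N)·⌊log₂ N⌋ ≤ 10N.
--    Lower: by Legendre's formula every prime power dividing C(2n, n) is at most 2n, so
--    2ⁿ ≤ C(2n, n) ≤ (2n)^{π(2n)}, whence N ≤ 3(⌊log₂ N⌋ + 1)·π(N).
-- 3. Combining both parts with ⌊log₂ (mc)⌋ + 1 ≤ (⌊log₂ c⌋ + 4)·⌊log₂ m⌋ gives S c m ≍ m / log m.

open import Defs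
open import Data.Nat
open import Data.Nat.Properties
open import Data.Nat.Divisibility
open import Data.Nat.DivMod using (_/_; _%_; m/n*n≡m; m≡m%n+[m/n]*n; m%n<n; m/n<m; m<n*o⇒m/o<n)
open import Data.Nat.Primality
open import Data.Nat.Primality.Factorisation using (factorise)
open import Data.Nat.Combinatorics using (_C_; nCk+nC[k+1]≡[n+1]C[k+1]; nCk≡n!/k![n-k]!; k![n∸k]!∣n!; nCk≡nC[n∸k])
open import Data.Nat.Logarithm using (⌊log₂_⌋; ⌊log₂⌋-mono-≤; ⌊log₂[2^n]⌋≡n; ⌊log₂⌊n/2⌋⌋≡⌊log₂n⌋∸1)
open import Data.Nat.Induction using (<-rec)
open import Data.Nat.ListAction using (sum; product)
open import Data.Nat.ListAction.Properties using (sum-++)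
open import Data.Nat.Tactic.RingSolver using (solve-∀)
open import Data.List using (List; []; _∷_; length; filter; map; upTo; _++_; _∷ʳ_; [_])
open import Data.List.Properties
  using (length-++; filter-++; upTo-∷ʳ; map-++; map-id; length-filter; length-map; length-upTo)
open import Data.List.Relation.Unary.All using (_∷_)
open import Data.Product using (_×_; ∃-syntax; _,_)
open import Data.Sum using (_⊎_; inj₁; inj₂)
open import Relation.Nullary using (¬_; yes; no; contradiction)
open import Relation.Binary.PropositionalEquality hiding ([_])

primeBit : ℕ → ℕ
primeBit n with prime? n
... | yes _ = 1
... | no  _ = 0

primeBit≤1 : ∀ n → primeBit n ≤ 1
primeBit≤1 n with prime? n
... | yes _ = ≤-refl
... | no  _ = z≤n

primeBit-composite : ∀ {n} → ¬ Prime n → primeBit n ≡ 0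
primeBit-composite {n} ¬p with prime? n
... | yes p = contradiction p ¬p
... | no  _ = refl

-- primesBelow n = π(n − 1) is the number of primes p < n; it is the recursive form of
-- primeCount used throughout (primeCount x = primesBelow (x + 1) below).
primesBelow : ℕ → ℕ
primesBelow zero    = 0
primesBelow (suc n) = primesBelow n + primeBit n

countPrimes-∷ʳ : ∀ xs x → length (filter prime? (xs ∷ʳ x)) ≡ length (filter prime? xs) + primeBit x
countPrimes-∷ʳ xs x rewrite filter-++ prime? xs [ x ] | length-++ (filter prime? xs) {filter prime? [ x ]}
  = cong (length (filter prime? xs) +_) (single x)
  where
  single : ∀ x → length (filter prime? [ x ]) ≡ primeBit x
  single x with prime? x
  ... | yes _ = refl
  ... | no  _ = refl

primesBelow-+ : ∀ lo len → primesBelow (lo + len) ≡ primesBelow lo + length (primesIn lo len)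
primesBelow-+ lo zero = trans (cong primesBelow (+-identityʳ lo)) (sym (+-identityʳ (primesBelow lo)))
primesBelow-+ lo (suc len) = begin
  primesBelow (lo + suc len)                                ≡⟨ cong primesBelow (+-suc lo len) ⟩
  primesBelow (lo + len) + primeBit (lo + len)              ≡⟨ cong (_+ primeBit (lo + len)) (primesBelow-+ lo len) ⟩
  primesBelow lo + length (primesIn lo len) + primeBit (lo + len)
                                                            ≡⟨ +-assoc (primesBelow lo) _ _ ⟩
  primesBelow lo + (length (primesIn lo len) + primeBit (lo + len))
                                                            ≡⟨ cong (primesBelow lo +_) (sym (countPrimes-∷ʳ candidates (lo + len))) ⟩
  primesBelow lo + length (filter prime? (candidates ∷ʳ (lo + len)))
                                                            ≡⟨ cong (λ xs → primesBelow lo + length (filter prime? xs)) snoc ⟩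
  primesBelow lo + length (primesIn lo (suc len))           ∎
  where
  open ≡-Reasoning
  candidates : List ℕ
  candidates = map (lo +_) (upTo len)
  snoc : candidates ∷ʳ (lo + len) ≡ map (lo +_) (upTo (suc len))
  snoc = trans (sym (map-++ (lo +_) (upTo len) [ len ])) (cong (map (lo +_)) (upTo-∷ʳ len))

primeCount≡primesBelow : ∀ x → primeCount x ≡ primesBelow (suc x)
primeCount≡primesBelow x = begin
  length (filter prime? (upTo (suc x)))                  ≡⟨ cong (λ xs → length (filter prime? xs)) (sym (map-id (upTo (suc x)))) ⟩
  length (primesIn 0 (suc x))                           ≡⟨ sym (primesBelow-+ 0 (suc x)) ⟩
  primesBelow (suc x)                                   ∎
  where open ≡-Reasoning

primesBelow-mono : ∀ {a b} → a ≤ b → primesBelow a ≤ primesBelow b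
primesBelow-mono {a} {b} a≤b with m≤n⇒∃[o]m+o≡n a≤b
... | o , refl = begin
  primesBelow a                             ≤⟨ m≤m+n (primesBelow a) _ ⟩
  primesBelow a + length (primesIn a o)     ≡⟨ sym (primesBelow-+ a o) ⟩
  primesBelow (a + o)                       ∎
  where open ≤-Reasoning

-- Trivial bound: among 0, 1, …, x at most x numbers are prime (0 is not).
primesBelow-suc≤ : ∀ x → primesBelow (suc x) ≤ x
primesBelow-suc≤ zero    = z≤n
primesBelow-suc≤ (suc x) = subst (_≤ suc x) (+-comm (primeBit (suc x)) (primesBelow (suc x)))
                             (+-mono-≤ (primeBit≤1 (suc x)) (primesBelow-suc≤ x))

S-suc : ∀ c m → S c (suc m) ≡ S c m + χI c (suc m)
S-suc c m = begin
  sum (map χ (upTo (suc m)))          ≡⟨ cong (λ js → sum (map χ js)) (sym (upTo-∷ʳ m)) ⟩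
  sum (map χ (upTo m ++ [ m ]))       ≡⟨ cong sum (map-++ χ (upTo m) [ m ]) ⟩
  sum (map χ (upTo m) ++ [ χ m ])     ≡⟨ sum-++ (map χ (upTo m)) [ χ m ] ⟩
  S c m + (χ m + 0)                   ≡⟨ cong (S c m +_) (+-identityʳ (χ m)) ⟩
  S c m + χ m                         ∎
  where
  open ≡-Reasoning
  χ : ℕ → ℕ
  χ j = χI c (suc j)

primesBelow-block : ∀ c m → primesBelow (suc m * c) ≡ primesBelow (m * c) + length (primesIn (m * c) c)
primesBelow-block c m = trans (cong primesBelow (+-comm c (m * c))) (primesBelow-+ (m * c) c)

primesIn-length≤ : ∀ lo c → length (primesIn lo c) ≤ c
primesIn-length≤ lo c = ≤-trans (length-filter prime? (map (lo +_) (upTo c)))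
  (≤-reflexive (trans (length-map (lo +_) (upTo c)) (length-upTo c)))

indicator≤length : ∀ (xs : List ℕ) → indicator xs ≤ length xs
indicator≤length []      = z≤n
indicator≤length (_ ∷ _) = s≤s z≤n

length≤c*indicator : ∀ c (xs : List ℕ) → length xs ≤ c → length xs ≤ c * indicator xs
length≤c*indicator c []      _  = z≤n
length≤c*indicator c (_ ∷ _) ≤c = ≤-trans ≤c (≤-reflexive (sym (*-identityʳ c)))

indicator≤1 : ∀ (xs : List ℕ) → indicator xs ≤ 1
indicator≤1 []      = z≤n
indicator≤1 (_ ∷ _) = ≤-refl

primesBelow≤c*S : ∀ c m → primesBelow (m * c) ≤ c * S c m
primesBelow≤c*S c zero    = z≤n
primesBelow≤c*S c (suc m) = begin
  primesBelow (suc m * c)                                   ≡⟨ primesBelow-block c m ⟩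
  primesBelow (m * c) + length (primesIn (m * c) c)         ≤⟨ +-mono-≤ (primesBelow≤c*S c m)
                                                                 (length≤c*indicator c _ (primesIn-length≤ (m * c) c)) ⟩
  c * S c m + c * χI c (suc m)                              ≡⟨ sym (*-distribˡ-+ c (S c m) _) ⟩
  c * (S c m + χI c (suc m))                                ≡⟨ cong (c *_) (sym (S-suc c m)) ⟩
  c * S c (suc m)                                           ∎
  where open ≤-Reasoning

S-defect-step : ∀ c m d → d + S c m ≤ primesBelow (m * c) → d + S c (suc m) ≤ primesBelow (suc m * c)
S-defect-step c m d hyp = begin
  d + S c (suc m)                                      ≡⟨ cong (d +_) (S-suc c m) ⟩
  d + (S c m + χI c (suc m))                           ≡⟨ sym (+-assoc d (S c m) _) ⟩
  d + S c m + χI c (suc m)                             ≤⟨ +-mono-≤ hyp (indicator≤length _) ⟩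
  primesBelow (m * c) + length (primesIn (m * c) c)    ≡⟨ sym (primesBelow-block c m) ⟩
  primesBelow (suc m * c)                              ∎
  where open ≤-Reasoning

S-defect-mono : ∀ c m₀ d → d + S c m₀ ≤ primesBelow (m₀ * c) → ∀ m → m₀ ≤ m → d + S c m ≤ primesBelow (m * c)
S-defect-mono c m₀ d base m m₀≤m with m≤n⇒∃[o]m+o≡n m₀≤m
... | o , refl = go o
  where
  go : ∀ o → d + S c (m₀ + o) ≤ primesBelow ((m₀ + o) * c)
  go zero    rewrite +-identityʳ m₀ = base
  go (suc o) rewrite +-suc m₀ o = S-defect-step c (m₀ + o) d (go o)

S≤primesBelow : ∀ c m → S c m ≤ primesBelow (m * c)
S≤primesBelow c m = S-defect-mono c 0 0 z≤n m z≤n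

S-defect-from-block : ∀ c m → 2 ≤ length (primesIn (m * c) c) → 1 + S c (suc m) ≤ primesBelow (suc m * c)
S-defect-from-block c m two = begin
  1 + S c (suc m)                                      ≡⟨ cong suc (trans (S-suc c m) (+-comm (S c m) _)) ⟩
  1 + χI c (suc m) + S c m                             ≤⟨ +-mono-≤ (≤-trans (s≤s (indicator≤1 _)) two) (S≤primesBelow c m) ⟩
  length (primesIn (m * c) c) + primesBelow (m * c)    ≡⟨ trans (+-comm _ (primesBelow (m * c))) (sym (primesBelow-block c m)) ⟩
  primesBelow (suc m * c)                              ∎
  where open ≤-Reasoning

-- Right-hand inequality of the theorem: for c ≥ 3 and m ≥ 2, S c m < π(mc).
-- For c = 3 the block [3, 6) contains 3 and 5; for c ≥ 4 the block [0, c) contains 2 and 3.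
S<primesBelow : ∀ c m → 3 ≤ c → 2 ≤ m → S c m < primesBelow (m * c)
S<primesBelow c m 3≤c 2≤m = S-defect-mono c 2 1 (two-blocks c 3≤c) m 2≤m
  where
  two-blocks : ∀ c → 3 ≤ c → 1 + S c 2 ≤ primesBelow (2 * c)
  two-blocks 0 ()
  two-blocks 1 (s≤s ())
  two-blocks 2 (s≤s (s≤s ()))
  two-blocks 3                   _ = S-defect-from-block 3 1 (s≤s (s≤s z≤n))
  two-blocks c@(suc (suc (suc (suc _)))) _ = S-defect-step c 1 1 (S-defect-from-block c 0 (s≤s (s≤s z≤n)))

product-not-prime : ∀ m c → 2 ≤ m → 2 ≤ c → ¬ Prime (m * c)
product-not-prime m 0 _ () _
product-not-prime m 1 _ (s≤s ()) _
product-not-prime m c@(suc (suc _)) 2≤m _ p = prime⇒¬composite p (composite c<mc (n∣m*n m))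
  where
  c<mc : c < m * c
  c<mc = subst (_< m * c) (*-identityˡ c) (*-monoˡ-< c 2≤m)

primesBelow-suc-composite : ∀ {x} → ¬ Prime x → primesBelow (suc x) ≡ primesBelow x
primesBelow-suc-composite {x} ¬p = begin
  primesBelow x + primeBit x          ≡⟨ cong (primesBelow x +_) (primeBit-composite ¬p) ⟩
  primesBelow x + 0                   ≡⟨ +-identityʳ _ ⟩
  primesBelow x                       ∎
  where open ≡-Reasoning

C≤2^ : ∀ n k → n C k ≤ 2 ^ n
C≤2^ zero    zero    = ≤-refl
C≤2^ zero    (suc k) = z≤n
C≤2^ (suc n) zero    = m^n>0 2 (suc n)
C≤2^ (suc n) (suc k) = begin
  suc n C suc k          ≡⟨ sym (nCk+nC[k+1]≡[n+1]C[k+1] n k) ⟩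
  n C k + n C suc k      ≤⟨ +-mono-≤ (C≤2^ n k) (C≤2^ n (suc k)) ⟩
  2 ^ n + 2 ^ n          ≡⟨ cong (2 ^ n +_) (sym (+-identityʳ (2 ^ n))) ⟩
  2 ^ suc n              ∎
  where open ≤-Reasoning

C≤C-suc : ∀ n k → n C k ≤ suc n C suc k
C≤C-suc n k = ≤-trans (m≤m+n (n C k) (n C suc k)) (≤-reflexive (nCk+nC[k+1]≡[n+1]C[k+1] n k))

-- C(2n+2, n+1) = C(2n+1, n) + C(2n+1, n+1) = 2·C(2n+1, n+1) ≥ 2·C(2n, n), hence 2ⁿ ≤ C(2n, n).
2^≤central : ∀ n → 2 ^ n ≤ (n + n) C n
2^≤central zero    = ≤-refl
2^≤central (suc n) = begin
  2 * 2 ^ n                               ≤⟨ *-monoʳ-≤ 2 (≤-trans (2^≤central n) (C≤C-suc (n + n) n)) ⟩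
  2 * ((suc n + n) C suc n)               ≡⟨ cong (_+ ((suc n + n) C suc n + 0)) (sym symmetric) ⟩
  (suc n + n) C n + ((suc n + n) C suc n + 0)
                                          ≡⟨ cong ((suc n + n) C n +_) (+-identityʳ _) ⟩
  (suc n + n) C n + (suc n + n) C suc n   ≡⟨ nCk+nC[k+1]≡[n+1]C[k+1] (suc n + n) n ⟩
  suc (suc n + n) C suc n                 ≡⟨ cong (λ z → suc z C suc n) (sym (+-suc n n)) ⟩
  (suc n + suc n) C suc n                 ∎
  where
  open ≤-Reasoning
  symmetric : (suc n + n) C n ≡ (suc n + n) C suc n
  symmetric = trans (nCk≡nC[n∸k] (m≤n+m n (suc n))) (cong ((suc n + n) C_) (m+n∸n≡m (suc n) n))

central-factorial : ∀ n → ((n + n) C n) * (n ! * n !) ≡ (n + n) !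
central-factorial n = subst (λ z → ((n + n) C n) * (n ! * z !) ≡ (n + n) !) (m+n∸n≡m n n) general
  where
  n≤2n : n ≤ n + n
  n≤2n = m≤m+n n n
  general : ((n + n) C n) * (n ! * (n + n ∸ n) !) ≡ (n + n) !
  general = trans (cong (_* (n ! * (n + n ∸ n) !)) (nCk≡n!/k![n-k]! n≤2n))
                  (m/n*n≡m {{n !* (n + n ∸ n) !≢0}} (k![n∸k]!∣n! n≤2n))

-- In particular C(2n, n) ≠ 0, as needed to turn divisibility into an inequality.
central≢0 : ∀ n → NonZero ((n + n) C n)
central≢0 n = >-nonZero (≤-trans (m^n>0 2 n) (2^≤central n))

prime∤1 : ∀ {p} → Prime p → ¬ p ∣ 1
prime∤1 pp p∣1 = ¬prime[1] (subst Prime (∣1⇒≡1 p∣1) pp)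

prime∤* : ∀ {p a b} → Prime p → ¬ p ∣ a → ¬ p ∣ b → ¬ p ∣ a * b
prime∤* {a = a} {b} pp p∤a p∤b p∣ab with euclidsLemma a b pp p∣ab
... | inj₁ p∣a = p∤a p∣a
... | inj₂ p∣b = p∤b p∣b

prime∤factorial : ∀ {p} → Prime p → ∀ n → n < p → ¬ p ∣ n !
prime∤factorial pp zero    _   = prime∤1 pp
prime∤factorial pp (suc n) n<p = prime∤* pp (λ p∣n+1 → <⇒≱ n<p (∣⇒≤ p∣n+1))
                                            (prime∤factorial pp n (<-trans (n<1+n n) n<p))

-- Every prime p with n < p ≤ 2n divides C(2n, n): it divides (2n)! but not n! · n!.
prime∣central : ∀ {p} n → Prime p → n < p → p ≤ n + n → p ∣ (n + n) C n
prime∣central {p@(suc q)} n pp n<p p≤2n with euclidsLemma ((n + n) C n) (n ! * n !) pp p∣product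
  where
  p∣product : p ∣ ((n + n) C n) * (n ! * n !)
  p∣product = subst (p ∣_) (sym (central-factorial n)) (∣-trans (m∣m*n (q !)) (m≤n⇒m!∣n! p≤2n))
... | inj₁ p∣C   = p∣C
... | inj₂ p∣n!² = contradiction p∣n!² (prime∤* pp (prime∤factorial pp n n<p) (prime∤factorial pp n n<p))

primeOrOne : ℕ → ℕ
primeOrOne x with prime? x
... | yes _ = x
... | no  _ = 1

primesProduct : ℕ → ℕ → ℕ
primesProduct n zero    = 1
primesProduct n (suc k) = primesProduct n k * primeOrOne (suc n + k)

prime∤primesProduct : ∀ n k {x} → Prime x → suc n + k ≤ x → ¬ x ∣ primesProduct n k
prime∤primesProduct n zero    px _   = prime∤1 px
prime∤primesProduct n (suc k) {x} px n+k<x = prime∤* px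
  (prime∤primesProduct n k px (≤-trans (+-monoʳ-≤ (suc n) (n≤1+n k)) n+k<x))
  (last (subst (_≤ x) (+-suc (suc n) k) n+k<x))
  where
  last : suc (suc n + k) ≤ x → ¬ x ∣ primeOrOne (suc n + k)
  last lt d with prime? (suc n + k)
  ... | yes _ = <⇒≱ lt (∣⇒≤ d)
  ... | no  _ = prime∤1 px d

-- The primes in (n, 2n] are distinct prime divisors of C(2n, n), so their product divides it.
primesProduct∣central : ∀ n k → k ≤ n → primesProduct n k ∣ (n + n) C n
primesProduct∣central n zero    _   = 1∣ _
primesProduct∣central n (suc k) k<n with primesProduct∣central n k (<⇒≤ k<n) | prime? (suc n + k)
... | P∣C | no  _  = subst (_∣ (n + n) C n) (sym (*-identityʳ _)) P∣C
... | divides q C≡qP | yes py = subst (P * y ∣_) (trans (*-comm P q) (sym C≡qP)) (*-monoʳ-∣ P y∣q)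
  where
  P : ℕ
  P = primesProduct n k
  y : ℕ
  y = suc n + k
  y∣qP : y ∣ q * P
  y∣qP = subst (y ∣_) C≡qP (prime∣central n py (s≤s (m≤m+n n k)) (subst (_≤ n + n) (+-suc n k) (+-monoʳ-≤ n k<n)))
  y∣q : y ∣ q
  y∣q with euclidsLemma q P py y∣qP
  ... | inj₁ y∣q = y∣q
  ... | inj₂ y∣P = contradiction y∣P (prime∤primesProduct n k py ≤-refl)

pow-primeBit≤primeOrOne : ∀ n y → suc n ≤ y → suc n ^ primeBit y ≤ primeOrOne y
pow-primeBit≤primeOrOne n y n<y with prime? y
... | yes _ = subst (_≤ y) (sym (*-identityʳ (suc n))) n<y
... | no  _ = ≤-refl

-- Every prime in (n, n + k] is at least n + 1, so (n+1)^{#primes in (n, n+k]} ≤ their product.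
pow-primesBelow≤ : ∀ n k → suc n ^ primesBelow (suc n + k) ≤ suc n ^ primesBelow (suc n) * primesProduct n k
pow-primesBelow≤ n zero = ≤-reflexive (trans (cong (λ z → suc n ^ primesBelow z) (+-identityʳ (suc n)))
                                               (sym (*-identityʳ _)))
pow-primesBelow≤ n (suc k) = begin
  suc n ^ primesBelow (suc n + suc k)                      ≡⟨ cong (λ z → suc n ^ primesBelow z) (+-suc (suc n) k) ⟩
  suc n ^ (primesBelow (suc n + k) + primeBit y)           ≡⟨ ^-distribˡ-+-* (suc n) (primesBelow (suc n + k)) (primeBit y) ⟩
  suc n ^ primesBelow (suc n + k) * suc n ^ primeBit y     ≤⟨ *-mono-≤ (pow-primesBelow≤ n k)
                                                                (pow-primeBit≤primeOrOne n y (m≤m+n (suc n) k)) ⟩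
  suc n ^ primesBelow (suc n) * primesProduct n k * primeOrOne y
                                                           ≡⟨ *-assoc (suc n ^ primesBelow (suc n)) (primesProduct n k) (primeOrOne y) ⟩
  suc n ^ primesBelow (suc n) * primesProduct n (suc k)    ∎
  where
  open ≤-Reasoning
  y : ℕ
  y = suc n + k

-- Chebyshev's inequality: (n+1)^{π(2n) − π(n)} ≤ ∏_{n<p≤2n} p ≤ C(2n, n) ≤ 4ⁿ.
chebyshev-step : ∀ n → suc n ^ primesBelow (suc n + n) ≤ suc n ^ primesBelow (suc n) * 2 ^ (n + n)
chebyshev-step n = ≤-trans (pow-primesBelow≤ n n) (*-monoʳ-≤ (suc n ^ primesBelow (suc n)) product≤4ⁿ)
  where
  product≤4ⁿ : primesProduct n n ≤ 2 ^ (n + n)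
  product≤4ⁿ = ≤-trans (∣⇒≤ {{central≢0 n}} (primesProduct∣central n n ≤-refl)) (C≤2^ (n + n) n)

^-cancelʳ-≤ : ∀ b {m n} → 1 < b → b ^ m ≤ b ^ n → m ≤ n
^-cancelʳ-≤ b {m} {n} 1<b bᵐ≤bⁿ with m ≤? n
... | yes m≤n = m≤n
... | no  m≰n = contradiction bᵐ≤bⁿ (<⇒≱ (^-monoʳ-< b 1<b (≰⇒> m≰n)))

-- N < 2^(⌊log₂ N⌋ + 1), since otherwise ⌊log₂ N⌋ ≥ ⌊log₂ 2^(⌊log₂ N⌋ + 1)⌋ = ⌊log₂ N⌋ + 1.
log₂-upper : ∀ N → N < 2 ^ suc ⌊log₂ N ⌋
log₂-upper N with N <? 2 ^ suc ⌊log₂ N ⌋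
... | yes N<2^ = N<2^
... | no  N≮2^ = contradiction (⌊log₂⌋-mono-≤ (≮⇒≥ N≮2^)) (λ le → 1+n≰n (subst (_≤ ⌊log₂ N ⌋) (⌊log₂[2^n]⌋≡n _) le))

-- 2^⌊log₂ N⌋ ≤ N for N ≥ 1, by strong induction using ⌊log₂ N⌋ = ⌊log₂ ⌊N/2⌋⌋ + 1 for N ≥ 2.
log₂-lower : ∀ N → 1 ≤ N → 2 ^ ⌊log₂ N ⌋ ≤ N
log₂-lower = <-rec (λ N → 1 ≤ N → 2 ^ ⌊log₂ N ⌋ ≤ N) halve
  where
  halve : ∀ N → (∀ {h} → h < N → 1 ≤ h → 2 ^ ⌊log₂ h ⌋ ≤ h) → 1 ≤ N → 2 ^ ⌊log₂ N ⌋ ≤ N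
  halve 1 _ _ = ≤-refl
  halve N@(suc (suc n)) rec _ = begin
    2 ^ ⌊log₂ N ⌋            ≡⟨ cong (2 ^_) log-halve ⟩
    2 * 2 ^ ⌊log₂ h ⌋        ≤⟨ *-monoʳ-≤ 2 (rec (⌊n/2⌋<n (suc n)) (s≤s z≤n)) ⟩
    h + (h + 0)              ≡⟨ cong (h +_) (+-identityʳ h) ⟩
    h + h                    ≤⟨ +-monoʳ-≤ h (⌊n/2⌋≤⌈n/2⌉ N) ⟩
    h + ⌈ N /2⌉              ≡⟨ ⌊n/2⌋+⌈n/2⌉≡n N ⟩
    N                        ∎
    where
    open ≤-Reasoning
    h : ℕ
    h = ⌊ N /2⌋
    log-halve : ⌊log₂ N ⌋ ≡ suc ⌊log₂ h ⌋
    log-halve = trans (sym (m∸n+n≡m (⌊log₂⌋-mono-≤ {2} {N} (s≤s (s≤s z≤n)))))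
                      (trans (+-comm _ 1) (cong suc (sym (⌊log₂⌊n/2⌋⌋≡⌊log₂n⌋∸1 N))))

-- ⌊log₂ (m c)⌋ ≤ ⌊log₂ m⌋ + ⌊log₂ c⌋ + 2, since m c < 2^(⌊log₂ m⌋+1) · 2^(⌊log₂ c⌋+1).
log₂-* : ∀ m c → ⌊log₂ (m * c) ⌋ ≤ ⌊log₂ m ⌋ + ⌊log₂ c ⌋ + 2
log₂-* m c = subst (⌊log₂ (m * c) ⌋ ≤_) (⌊log₂[2^n]⌋≡n _) (⌊log₂⌋-mono-≤ mc≤2^)
  where
  mc≤2^ : m * c ≤ 2 ^ (⌊log₂ m ⌋ + ⌊log₂ c ⌋ + 2)
  mc≤2^ = begin
    m * c                                         ≤⟨ *-mono-≤ (<⇒≤ (log₂-upper m)) (<⇒≤ (log₂-upper c)) ⟩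
    2 ^ suc ⌊log₂ m ⌋ * 2 ^ suc ⌊log₂ c ⌋         ≡⟨ sym (^-distribˡ-+-* 2 (suc ⌊log₂ m ⌋) (suc ⌊log₂ c ⌋)) ⟩
    2 ^ (suc ⌊log₂ m ⌋ + suc ⌊log₂ c ⌋)           ≡⟨ cong (2 ^_) (exponents ⌊log₂ m ⌋ ⌊log₂ c ⌋) ⟩
    2 ^ (⌊log₂ m ⌋ + ⌊log₂ c ⌋ + 2)               ∎
    where
    open ≤-Reasoning
    exponents : ∀ a b → suc a + suc b ≡ a + b + 2
    exponents = solve-∀

dyadicPrimes : ℕ → ℕ
dyadicPrimes k = primesBelow (suc (2 ^ k))

-- Chebyshev's inequality at n = 2ᵏ, after taking logarithms to base 2:
-- k · π(2ᵏ⁺¹) ≤ (k + 1) · π(2ᵏ) + 2ᵏ⁺¹.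
dyadic-step : ∀ k → k * dyadicPrimes (suc k) ≤ suc k * dyadicPrimes k + 2 ^ suc k
dyadic-step k = ^-cancelʳ-≤ 2 (s≤s (s≤s z≤n)) (begin
  2 ^ (k * dyadicPrimes (suc k))                    ≡⟨ sym (^-*-assoc 2 k (dyadicPrimes (suc k))) ⟩
  n ^ dyadicPrimes (suc k)                          ≤⟨ ^-monoˡ-≤ (dyadicPrimes (suc k)) (n≤1+n n) ⟩
  suc n ^ dyadicPrimes (suc k)                      ≡⟨ cong (λ z → suc n ^ primesBelow (suc z)) 2n≡n+n ⟩
  suc n ^ primesBelow (suc n + n)                   ≤⟨ chebyshev-step n ⟩
  suc n ^ dyadicPrimes k * 2 ^ (n + n)              ≤⟨ *-monoˡ-≤ (2 ^ (n + n)) (^-monoˡ-≤ (dyadicPrimes k) n+1≤2n) ⟩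
  (2 ^ suc k) ^ dyadicPrimes k * 2 ^ (n + n)        ≡⟨ cong₂ _*_ (^-*-assoc 2 (suc k) (dyadicPrimes k)) (cong (2 ^_) (sym 2n≡n+n)) ⟩
  2 ^ (suc k * dyadicPrimes k) * 2 ^ (2 ^ suc k)    ≡⟨ sym (^-distribˡ-+-* 2 (suc k * dyadicPrimes k) (2 ^ suc k)) ⟩
  2 ^ (suc k * dyadicPrimes k + 2 ^ suc k)          ∎)
  where
  open ≤-Reasoning
  n : ℕ
  n = 2 ^ k
  2n≡n+n : 2 ^ suc k ≡ n + n
  2n≡n+n = cong (n +_) (+-identityʳ n)
  n+1≤2n : suc n ≤ 2 ^ suc k
  n+1≤2n = subst (suc n ≤_) (sym 2n≡n+n) (subst (_≤ n + n) (+-comm n 1) (+-monoʳ-≤ n (m^n>0 2 k)))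

-- Summing the dyadic steps: k · π(2ᵏ) ≤ 5 · 2ᵏ.
dyadic-bound : ∀ k → k * dyadicPrimes k ≤ 5 * 2 ^ k
dyadic-bound zero    = z≤n
dyadic-bound (suc k) = begin
  dyadicPrimes (suc k) + k * dyadicPrimes (suc k)                  ≤⟨ +-monoʳ-≤ (dyadicPrimes (suc k)) (dyadic-step k) ⟩
  dyadicPrimes (suc k) + (dyadicPrimes k + k * dyadicPrimes k + 2 ^ suc k)
                                                                   ≤⟨ +-mono-≤ (primesBelow-suc≤ (2 ^ suc k))
                                                                       (+-mono-≤ (+-mono-≤ (primesBelow-suc≤ (2 ^ k)) (dyadic-bound k)) ≤-refl) ⟩
  2 * 2 ^ k + (2 ^ k + 5 * 2 ^ k + 2 * 2 ^ k)                      ≡⟨ collect (2 ^ k) ⟩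
  5 * (2 * 2 ^ k)                                                  ∎
  where
  open ≤-Reasoning
  collect : ∀ x → 2 * x + (x + 5 * x + 2 * x) ≡ 5 * (2 * x)
  collect = solve-∀

chebyshev-upper : ∀ N → primesBelow (suc N) * ⌊log₂ N ⌋ ≤ 10 * N
chebyshev-upper zero = z≤n
chebyshev-upper N@(suc _) = begin
  primesBelow (suc N) * L             ≤⟨ *-mono-≤ (primesBelow-mono (s≤s (<⇒≤ (log₂-upper N)))) (n≤1+n L) ⟩
  dyadicPrimes (suc L) * suc L        ≡⟨ *-comm (dyadicPrimes (suc L)) (suc L) ⟩
  suc L * dyadicPrimes (suc L)        ≤⟨ dyadic-bound (suc L) ⟩
  5 * (2 * 2 ^ L)                     ≤⟨ *-monoʳ-≤ 5 (*-monoʳ-≤ 2 (log₂-lower N (s≤s z≤n))) ⟩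
  5 * (2 * N)                         ≡⟨ sym (*-assoc 5 2 N) ⟩
  10 * N                              ∎
  where
  open ≤-Reasoning
  L : ℕ
  L = ⌊log₂ N ⌋

-- Prime powers dividing C(2n, n), after Legendre: every p^e dividing C(2n, n) is at most 2n.
-- Throughout, p is a fixed prime and "unit" means a number not divisible by p.
module CentralPrimePowers (p : ℕ) (pp : Prime p) where

  private
    instance
      p≢0 : NonZero p
      p≢0 = prime⇒nonZero pp

  -- The multiples of p in [1, qp + r] (r < p) contribute exactly p^q · q! to (qp + r)!.
  factorial-split : ∀ q r → r < p → ∃[ u ] (¬ p ∣ u × (q * p + r) ! ≡ p ^ q * q ! * u)
  factorial-split zero zero _ = 1 , prime∤1 pp , refl
  factorial-split q (suc r) r+1<p with factorial-split q r (<-trans (n<1+n r) r+1<p)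
  ... | u , p∤u , split = suc (q * p + r) * u , prime∤* pp p∤factor p∤u , (begin
    (q * p + suc r) !                          ≡⟨ cong _! (+-suc (q * p) r) ⟩
    suc (q * p + r) * (q * p + r) !            ≡⟨ cong (suc (q * p + r) *_) split ⟩
    suc (q * p + r) * (p ^ q * q ! * u)        ≡⟨ rearrange (suc (q * p + r)) (p ^ q) (q !) u ⟩
    p ^ q * q ! * (suc (q * p + r) * u)        ∎)
    where
    open ≡-Reasoning
    p∤factor : ¬ p ∣ suc (q * p + r)
    p∤factor p∣ = <⇒≱ r+1<p (∣⇒≤ (∣m+n∣m⇒∣n (subst (p ∣_) (sym (+-suc (q * p) r)) p∣) (n∣m*n q)))
    rearrange : ∀ a b c d → a * (b * c * d) ≡ b * c * (a * d)
    rearrange = solve-∀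
  factorial-split (suc q) zero _ with factorial-split q (pred p) (≤-reflexive (suc-pred p))
  ... | u , p∤u , split = u , p∤u , (begin
    (suc q * p + 0) !                          ≡⟨ cong _! (trans (+-identityʳ _) (sym last)) ⟩
    suc (q * p + pred p) !                     ≡⟨ cong (suc (q * p + pred p) *_) split ⟩
    suc (q * p + pred p) * (p ^ q * q ! * u)   ≡⟨ cong (_* (p ^ q * q ! * u)) last ⟩
    (suc q * p) * (p ^ q * q ! * u)            ≡⟨ rearrange (suc q) p (p ^ q) (q !) u ⟩
    p * p ^ q * (suc q * q !) * u              ∎)
    where
    open ≡-Reasoning
    last : suc (q * p + pred p) ≡ suc q * p
    last = trans (sym (+-suc (q * p) (pred p))) (trans (cong (q * p +_) (suc-pred p)) (+-comm (q * p) p))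
    rearrange : ∀ a b c d e → (a * b) * (c * d * e) ≡ b * c * (a * d) * e
    rearrange = solve-∀

  -- A p-adic description of (2b + t)! / (b!)² for a carry t ≤ 1: (2b + t)! · W = p^E · (b!)² · U
  -- with units W and U, so E is the exponent of p in this quotient.  Legendre's bound is the
  -- field 'bounded': p^E ≤ 2b + t unless E = 0.
  record CentralPart (b t : ℕ) : Set where
    constructor centralPart
    field
      exponent      : ℕ
      W U           : ℕ
      p∤W           : ¬ p ∣ W
      p∤U           : ¬ p ∣ U
      factorisation : (b + b + t) ! * W ≡ p ^ exponent * (b ! * b !) * U
      bounded       : exponent ≡ 0 ⊎ p ^ exponent ≤ b + b + t

  carry : ∀ r t → r < p → t ≤ 1 → ∃[ t′ ] ∃[ r′ ] (t′ ≤ 1 × r′ < p × r + r + t ≡ t′ * p + r′)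
  carry r t r<p t≤1 = x / p , x % p , s≤s⁻¹ (m<n*o⇒m/o<n x<2p) , m%n<n x p , trans (m≡m%n+[m/n]*n x p) (+-comm (x % p) _)
    where
    x : ℕ
    x = r + r + t
    x<2p : x < 2 * p
    x<2p = begin-strict
      r + r + t               ≤⟨ +-monoʳ-≤ (r + r) t≤1 ⟩
      r + r + 1               <⟨ +-monoʳ-< (r + r) (n<1+n 1) ⟩
      r + r + 2               ≡⟨ shift r ⟩
      suc r + suc r           ≤⟨ +-mono-≤ r<p (subst (suc r ≤_) (sym (+-identityʳ p)) r<p) ⟩
      2 * p                   ∎
      where
      open ≤-Reasoning
      shift : ∀ r → r + r + 2 ≡ suc r + suc r
      shift = solve-∀

  -- Each carry contributes one factor p, so the exponent grows to t′ + E; the bound survives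
  -- because p^{t′+E} ≤ p · (2q + t′) ≤ 2b + t.
  exponent-bound : ∀ {s n} t′ E → t′ ≤ 1 → (E ≡ 0 ⊎ p ^ E ≤ s + t′) → s + t′ ≤ n → p * (s + t′) ≤ n
                   → t′ + E ≡ 0 ⊎ p ^ (t′ + E) ≤ n
  exponent-bound zero    E _ (inj₁ E≡0) _     _    = inj₁ E≡0
  exponent-bound zero    E _ (inj₂ pᴱ≤) s≤n   _    = inj₂ (≤-trans pᴱ≤ s≤n)
  exponent-bound {s} 1 .0 _ (inj₁ refl) _  ps≤n = inj₂ (≤-trans (*-monoʳ-≤ p (m≤n+m 1 s)) ps≤n)
  exponent-bound 1       E _ (inj₂ pᴱ≤) _     ps≤n = inj₂ (≤-trans (*-monoʳ-≤ p pᴱ≤) ps≤n)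
  exponent-bound (suc (suc _)) _ (s≤s ()) _ _ _

  -- The inductive step: for b = r + qp, Legendre's step applied to (2b + t)! and b! reduces
  -- (2b + t)!/(b!)² to p^{t′} · (2q + t′)!/(q!)², which the hypothesis describes.
  central-part-step : ∀ q r t t′ r′ → r < p → r′ < p → t′ ≤ 1 → r + r + t ≡ t′ * p + r′
                      → CentralPart q t′ → CentralPart (r + q * p) t
  central-part-step q r t t′ r′ r<p r′<p t′≤1 digit (centralPart E W U p∤W p∤U fact bnd)
    with factorial-split (q + q + t′) r′ r′<p | factorial-split q r r<p
  ... | u , p∤u , split-2b | w , p∤w , split-b =
    centralPart (t′ + E) (W * (w * w)) (u * U)
      (prime∤* pp p∤W (prime∤* pp p∤w p∤w)) (prime∤* pp p∤u p∤U) identity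
      (exponent-bound t′ E t′≤1 bnd (≤-trans (m≤m*n Q p) Qp≤2b+t) (≤-trans (≤-reflexive (*-comm p Q)) Qp≤2b+t))
    where
    open ≡-Reasoning
    b : ℕ
    b = r + q * p
    Q : ℕ
    Q = q + q + t′
    digits : b + b + t ≡ Q * p + r′
    digits = begin
      b + b + t                   ≡⟨ regroup q r t p ⟩
      (q + q) * p + (r + r + t)   ≡⟨ cong ((q + q) * p +_) digit ⟩
      (q + q) * p + (t′ * p + r′) ≡⟨ collect q t′ r′ p ⟩
      Q * p + r′                  ∎
      where
      regroup : ∀ q r t p → (r + q * p) + (r + q * p) + t ≡ (q + q) * p + (r + r + t)
      regroup = solve-∀
      collect : ∀ q t′ r′ p → (q + q) * p + (t′ * p + r′) ≡ (q + q + t′) * p + r′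
      collect = solve-∀
    Qp≤2b+t : Q * p ≤ b + b + t
    Qp≤2b+t = ≤-trans (m≤m+n (Q * p) r′) (≤-reflexive (sym digits))
    b!-split : b ! ≡ p ^ q * q ! * w
    b!-split = trans (cong _! (+-comm r (q * p))) split-b
    identity : (b + b + t) ! * (W * (w * w)) ≡ p ^ (t′ + E) * (b ! * b !) * (u * U)
    identity = begin
      (b + b + t) ! * (W * (w * w))                               ≡⟨ cong (λ z → z ! * (W * (w * w))) digits ⟩
      (Q * p + r′) ! * (W * (w * w))                              ≡⟨ cong (_* (W * (w * w))) split-2b ⟩
      p ^ Q * Q ! * u * (W * (w * w))                             ≡⟨ reorder₁ (p ^ Q) (Q !) u W w ⟩
      p ^ Q * u * w * w * (Q ! * W)                               ≡⟨ cong (p ^ Q * u * w * w *_) fact ⟩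
      p ^ Q * u * w * w * (p ^ E * (q ! * q !) * U)               ≡⟨ cong (λ z → z * u * w * w * (p ^ E * (q ! * q !) * U)) pᴼ ⟩
      p ^ q * p ^ q * p ^ t′ * u * w * w * (p ^ E * (q ! * q !) * U)
                                                                  ≡⟨ reorder₂ (p ^ q) (p ^ t′) u w (p ^ E) (q !) U ⟩
      p ^ t′ * p ^ E * ((p ^ q * q ! * w) * (p ^ q * q ! * w)) * (u * U)
                                                                  ≡⟨ cong₂ (λ x y → x * (y * y) * (u * U))
                                                                       (sym (^-distribˡ-+-* p t′ E)) (sym b!-split) ⟩
      p ^ (t′ + E) * (b ! * b !) * (u * U)                        ∎
      where
      pᴼ : p ^ Q ≡ p ^ q * p ^ q * p ^ t′
      pᴼ = trans (^-distribˡ-+-* p (q + q) t′) (cong (_* p ^ t′) (^-distribˡ-+-* p q q))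
      reorder₁ : ∀ a b c d e → a * b * c * (d * (e * e)) ≡ a * c * e * e * (b * d)
      reorder₁ = solve-∀
      reorder₂ : ∀ a t u w f g U → a * a * t * u * w * w * (f * (g * g) * U) ≡ t * f * ((a * g * w) * (a * g * w)) * (u * U)
      reorder₂ = solve-∀

  -- Every (b, t) admits such a description, by strong induction on b, since ⌊b/p⌋ < b.
  central-part : ∀ b t → t ≤ 1 → CentralPart b t
  central-part = <-rec (λ b → ∀ t → t ≤ 1 → CentralPart b t) step
    where
    step : ∀ b → (∀ {b′} → b′ < b → ∀ t → t ≤ 1 → CentralPart b′ t) → ∀ t → t ≤ 1 → CentralPart b t
    step zero _ t t≤1 = centralPart 0 1 1 (prime∤1 pp) (prime∤1 pp) (small t≤1) (inj₁ refl)
      where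
      small : ∀ {t} → t ≤ 1 → t ! * 1 ≡ 1 * (1 * 1) * 1
      small z≤n       = refl
      small (s≤s z≤n) = refl
    step b@(suc _) rec t t≤1 with carry (b % p) t (m%n<n b p) t≤1
    ... | t′ , r′ , t′≤1 , r′<p , digit =
      subst (λ b → CentralPart b t) (sym (m≡m%n+[m/n]*n b p))
        (central-part-step (b / p) (b % p) t t′ r′ (m%n<n b p) r′<p t′≤1 digit
          (rec (m/n<m b p (nonTrivial⇒n>1 p {{prime⇒nonTrivial pp}})) t′ t′≤1))

  pow∣pow*unit⇒≤ : ∀ e E U → ¬ p ∣ U → p ^ e ∣ p ^ E * U → e ≤ E
  pow∣pow*unit⇒≤ zero    E       U _   _ = z≤n
  pow∣pow*unit⇒≤ (suc e) zero    U p∤U d = contradiction (∣-trans (m∣m*n (p ^ e)) (subst (p ^ suc e ∣_) (+-identityʳ U) d)) p∤U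
  pow∣pow*unit⇒≤ (suc e) (suc E) U p∤U d =
    s≤s (pow∣pow*unit⇒≤ e E U p∤U (*-cancelˡ-∣ p (subst (p * p ^ e ∣_) (*-assoc p (p ^ E) U) d)))

  prime-power∣central⇒≤ : ∀ n → 1 ≤ n → ∀ e → p ^ e ∣ (n + n) C n → p ^ e ≤ n + n
  prime-power∣central⇒≤ n 1≤n e pᵉ∣C with central-part n 0 z≤n
  ... | centralPart E W U _ p∤U fact bnd = finish E e≤E bnd
    where
    Cₙ : ℕ
    Cₙ = (n + n) C n
    CW≡pᴱU : Cₙ * W ≡ p ^ E * U
    CW≡pᴱU = *-cancelʳ-≡ (Cₙ * W) (p ^ E * U) (n ! * n !) {{n !* n !≢0}} (begin
      Cₙ * W * (n ! * n !)          ≡⟨ swap Cₙ W (n ! * n !) ⟩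
      Cₙ * (n ! * n !) * W          ≡⟨ cong (_* W) (central-factorial n) ⟩
      (n + n) ! * W                 ≡⟨ cong (λ z → z ! * W) (sym (+-identityʳ (n + n))) ⟩
      (n + n + 0) ! * W             ≡⟨ fact ⟩
      p ^ E * (n ! * n !) * U       ≡⟨ swap (p ^ E) (n ! * n !) U ⟩
      p ^ E * U * (n ! * n !)       ∎)
      where
      open ≡-Reasoning
      swap : ∀ a b c → a * b * c ≡ a * c * b
      swap = solve-∀
    e≤E : e ≤ E
    e≤E = pow∣pow*unit⇒≤ e E U p∤U (subst (p ^ e ∣_) CW≡pᴱU (∣m⇒∣m*n W pᵉ∣C))
    finish : ∀ E → e ≤ E → E ≡ 0 ⊎ p ^ E ≤ n + n + 0 → p ^ e ≤ n + n
    finish .0 z≤n (inj₁ refl) = ≤-trans 1≤n (m≤m+n n n)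
    finish E  e≤E (inj₂ pᴱ≤)  = ≤-trans (^-monoʳ-≤ p e≤E) (subst (p ^ E ≤_) (+-identityʳ (n + n)) pᴱ≤)

no-prime-factor⇒≤1 : ∀ N → 1 ≤ N → (∀ {q} → Prime q → ¬ q ∣ N) → N ≤ 1
no-prime-factor⇒≤1 N@(suc _) _ none with factorise N
... | record { factors = []     ; isFactorisation = N≡1 } = ≤-reflexive N≡1
... | record { factors = q ∷ qs ; isFactorisation = N≡∏ ; factorsPrime = pq ∷ _ } =
  contradiction (subst (q ∣_) (sym N≡∏) (m∣m*n (product qs))) (none pq)

p-part : ∀ p → 1 < p → ∀ N → 1 ≤ N → ∃[ e ] ∃[ M ] (N ≡ p ^ e * M × ¬ p ∣ M)
p-part p 1<p = <-rec (λ N → 1 ≤ N → ∃[ e ] ∃[ M ] (N ≡ p ^ e * M × ¬ p ∣ M)) step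
  where
  step : ∀ N → (∀ {k} → k < N → 1 ≤ k → ∃[ e ] ∃[ M ] (k ≡ p ^ e * M × ¬ p ∣ M))
         → 1 ≤ N → ∃[ e ] ∃[ M ] (N ≡ p ^ e * M × ¬ p ∣ M)
  step N rec 1≤N with p ∣? N
  ... | no  p∤N = 0 , N , sym (+-identityʳ N) , p∤N
  ... | yes (divides zero N≡0) = contradiction (subst (0 <_) N≡0 1≤N) n≮0
  ... | yes (divides k@(suc _) N≡kp) with rec (subst (k <_) (sym N≡kp) (m<m*n k p 1<p)) (s≤s z≤n)
  ...   | e , M , k≡pᵉM , p∤M = suc e , M , N≡pᵉ⁺¹M , p∤M
    where
    N≡pᵉ⁺¹M : N ≡ p ^ suc e * M
    N≡pᵉ⁺¹M = begin
      N                  ≡⟨ N≡kp ⟩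
      k * p              ≡⟨ cong (_* p) k≡pᵉM ⟩
      p ^ e * M * p      ≡⟨ *-comm (p ^ e * M) p ⟩
      p * (p ^ e * M)    ≡⟨ sym (*-assoc p (p ^ e) M) ⟩
      p ^ suc e * M      ∎
      where open ≡-Reasoning

-- A number N ≥ 1 whose prime factors are all below n and whose prime-power divisors are all
-- at most B satisfies N ≤ B^{π(n)}: it is a product of at most π(n) prime powers, each ≤ B.
smooth-bound : ∀ B n N → 1 ≤ N → (∀ {q} → Prime q → q ∣ N → q < n)
               → (∀ {q} e → Prime q → q ^ e ∣ N → q ^ e ≤ B) → N ≤ B ^ primesBelow n
smooth-bound B zero N 1≤N below _ = no-prime-factor⇒≤1 N 1≤N (λ pq q∣N → n≮0 (below pq q∣N))
smooth-bound B (suc n) N 1≤N below powers with prime? n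
... | no ¬pn = subst (λ k → N ≤ B ^ k) (sym (+-identityʳ (primesBelow n))) (smooth-bound B n N 1≤N below′ powers)
  where
  below′ : ∀ {q} → Prime q → q ∣ N → q < n
  below′ {q} pq q∣N with m<1+n⇒m<n∨m≡n (below pq q∣N)
  ... | inj₁ q<n  = q<n
  ... | inj₂ refl = contradiction pq ¬pn
... | yes pn with p-part n (nonTrivial⇒n>1 n {{prime⇒nonTrivial pn}}) N 1≤N
...   | e , M , N≡nᵉM , n∤M = begin
  N                                ≡⟨ N≡nᵉM ⟩
  n ^ e * M                        ≤⟨ *-mono-≤ (powers e pn nᵉ∣N) (smooth-bound B n M 1≤M below′ (λ e pq d → powers e pq (∣-trans d M∣N))) ⟩
  B * B ^ primesBelow n            ≡⟨ *-comm B (B ^ primesBelow n) ⟩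
  B ^ primesBelow n * B            ≡⟨ cong (B ^ primesBelow n *_) (sym (*-identityʳ B)) ⟩
  B ^ primesBelow n * B ^ 1        ≡⟨ sym (^-distribˡ-+-* B (primesBelow n) 1) ⟩
  B ^ (primesBelow n + 1)          ∎
  where
  open ≤-Reasoning
  M∣N : M ∣ N
  M∣N = divides (n ^ e) N≡nᵉM
  nᵉ∣N : n ^ e ∣ N
  nᵉ∣N = divides M (trans N≡nᵉM (*-comm (n ^ e) M))
  1≤M : 1 ≤ M
  1≤M = n≢0⇒n>0 (λ M≡0 → n≮0 (subst (0 <_) (trans N≡nᵉM (trans (cong (n ^ e *_) M≡0) (*-zeroʳ (n ^ e)))) 1≤N))
  below′ : ∀ {q} → Prime q → q ∣ M → q < n
  below′ {q} pq q∣M with m<1+n⇒m<n∨m≡n (below pq (∣-trans q∣M M∣N))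
  ... | inj₁ q<n  = q<n
  ... | inj₂ refl = contradiction q∣M n∤M

-- By Legendre's bound C(2n, n) is (2n + 1)-smooth with prime-power divisors ≤ 2n,
-- hence C(2n, n) ≤ (2n)^{π(2n)}.
central≤ : ∀ n → 1 ≤ n → (n + n) C n ≤ (n + n) ^ primesBelow (suc (n + n))
central≤ n 1≤n = smooth-bound (n + n) (suc (n + n)) ((n + n) C n) (≤-trans (m^n>0 2 n) (2^≤central n)) below powers
  where
  powers : ∀ {q} e → Prime q → q ^ e ∣ (n + n) C n → q ^ e ≤ n + n
  powers e pq = CentralPrimePowers.prime-power∣central⇒≤ _ pq n 1≤n e
  below : ∀ {q} → Prime q → q ∣ (n + n) C n → q < suc (n + n)
  below {q} pq q∣C = s≤s (subst (_≤ n + n) (*-identityʳ q) (powers 1 pq (subst (_∣ (n + n) C n) (sym (*-identityʳ q)) q∣C)))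

-- Chebyshev's lower bound at even arguments: 2ⁿ ≤ C(2n, n) ≤ (2n)^{π(2n)} ≤ 2^{(⌊log₂ 2n⌋+1)·π(2n)}.
chebyshev-lower-even : ∀ n → 1 ≤ n → n ≤ suc ⌊log₂ (n + n) ⌋ * primesBelow (suc (n + n))
chebyshev-lower-even n 1≤n = ^-cancelʳ-≤ 2 (s≤s (s≤s z≤n)) (begin
  2 ^ n                     ≤⟨ 2^≤central n ⟩
  (n + n) C n               ≤⟨ central≤ n 1≤n ⟩
  (n + n) ^ π               ≤⟨ ^-monoˡ-≤ π (<⇒≤ (log₂-upper (n + n))) ⟩
  (2 ^ suc L) ^ π           ≡⟨ ^-*-assoc 2 (suc L) π ⟩
  2 ^ (suc L * π)           ∎)
  where
  open ≤-Reasoning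
  π : ℕ
  π = primesBelow (suc (n + n))
  L : ℕ
  L = ⌊log₂ (n + n) ⌋

≤3*half : ∀ N → 2 ≤ N → N ≤ 3 * ⌊ N /2⌋
≤3*half 1 (s≤s ())
≤3*half 2 _ = s≤s (s≤s z≤n)
≤3*half 3 _ = ≤-refl
≤3*half (suc (suc N@(suc (suc _)))) _ =
  subst (suc (suc N) ≤_) (sym (*-suc 3 ⌊ N /2⌋)) (+-mono-≤ (n≤1+n 2) (≤3*half N (s≤s (s≤s z≤n))))

-- Chebyshev's lower bound: N ≤ 3 · (⌊log₂ N⌋ + 1) · π(N) for N ≥ 2, applied at n = ⌊N/2⌋.
chebyshev-lower : ∀ N → 2 ≤ N → N ≤ 3 * (suc ⌊log₂ N ⌋ * primesBelow (suc N))
chebyshev-lower N 2≤N = begin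
  N                                                ≤⟨ ≤3*half N 2≤N ⟩
  3 * n                                            ≤⟨ *-monoʳ-≤ 3 (chebyshev-lower-even n (⌊n/2⌋-mono 2≤N)) ⟩
  3 * (suc ⌊log₂ (n + n) ⌋ * primesBelow (suc (n + n)))
                                                   ≤⟨ *-monoʳ-≤ 3 (*-mono-≤ (s≤s (⌊log₂⌋-mono-≤ 2n≤N)) (primesBelow-mono (s≤s 2n≤N))) ⟩
  3 * (suc ⌊log₂ N ⌋ * primesBelow (suc N))        ∎
  where
  open ≤-Reasoning
  n : ℕ
  n = ⌊ N /2⌋
  2n≤N : n + n ≤ N
  2n≤N = subst (n + n ≤_) (⌊n/2⌋+⌈n/2⌉≡n N) (+-monoʳ-≤ n (⌊n/2⌋≤⌈n/2⌉ N))

-- ⌊log₂ (mc)⌋ + 1 ≤ (⌊log₂ c⌋ + 4) · ⌊log₂ m⌋ for m ≥ 2, so log (mc) ≪ log m for fixed c.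
-- As m ≥ 2, ⌊log₂ m⌋ = l + 1 for some l, and ⌊log₂ (mc)⌋ ≤ (l + 1) + ⌊log₂ c⌋ + 2.
log₂-*-≤ : ∀ m c → 2 ≤ m → suc ⌊log₂ (m * c) ⌋ ≤ (⌊log₂ c ⌋ + 4) * ⌊log₂ m ⌋
log₂-*-≤ m c 2≤m with ⌊log₂ m ⌋ | ⌊log₂⌋-mono-≤ {2} {m} 2≤m | log₂-* m c
... | suc l | _ | log-mc≤ = begin
  suc ⌊log₂ (m * c) ⌋              ≤⟨ s≤s log-mc≤ ⟩
  suc (suc l + a + 2)             ≡⟨ regroup a l ⟩
  (a + 4) + l                     ≤⟨ +-monoʳ-≤ (a + 4) (m≤n*m l (a + 4) {{>-nonZero (≤-trans (s≤s z≤n) (m≤n+m 4 a))}}) ⟩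
  (a + 4) + (a + 4) * l           ≡⟨ sym (*-suc (a + 4) l) ⟩
  (a + 4) * suc l                 ∎
  where
  open ≤-Reasoning
  a : ℕ
  a = ⌊log₂ c ⌋
  regroup : ∀ a l → suc (suc l + a + 2) ≡ (a + 4) + l
  regroup = solve-∀

block-bounds : ∀ c m → 3 ≤ c → 2 ≤ m → primeCount (m * c) ≤ c * S c m × S c m < primeCount (m * c)
block-bounds c m 3≤c 2≤m = subst (λ π → π ≤ c * S c m × S c m < π) (sym primeCount≡primesBelow-mc)
  (primesBelow≤c*S c m , S<primesBelow c m 3≤c 2≤m)
  where
  primeCount≡primesBelow-mc : primeCount (m * c) ≡ primesBelow (m * c)
  primeCount≡primesBelow-mc = trans (primeCount≡primesBelow (m * c))
    (primesBelow-suc-composite (product-not-prime m c 2≤m (≤-trans (n≤1+n 2) 3≤c)))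

-- Upper half of S c m ≍ m / log m: S c m · ⌊log₂ m⌋ ≤ π(mc) · ⌊log₂ (mc)⌋ ≤ 10 c m.
S-log-upper : ∀ c m → 1 ≤ c → S c m * ⌊log₂ m ⌋ ≤ 10 * c * m
S-log-upper c m 1≤c = begin
  S c m * ⌊log₂ m ⌋                        ≤⟨ *-mono-≤ (≤-trans (S≤primesBelow c m) (primesBelow-mono (n≤1+n (m * c))))
                                                        (⌊log₂⌋-mono-≤ (m≤m*n m c {{>-nonZero 1≤c}})) ⟩
  primesBelow (suc (m * c)) * ⌊log₂ (m * c) ⌋ ≤⟨ chebyshev-upper (m * c) ⟩
  10 * (m * c)                             ≡⟨ cong (10 *_) (*-comm m c) ⟩
  10 * (c * m)                             ≡⟨ sym (*-assoc 10 c m) ⟩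
  10 * c * m                               ∎
  where open ≤-Reasoning

-- Lower half of S c m ≍ m / log m: m ≤ mc ≤ 3 (⌊log₂ mc⌋ + 1) π(mc) ≤ 3 (⌊log₂ c⌋ + 4) ⌊log₂ m⌋ · c S c m.
S-log-lower : ∀ c m → 2 ≤ c → 2 ≤ m → m ≤ 3 * (⌊log₂ c ⌋ + 4) * c * (S c m * ⌊log₂ m ⌋)
S-log-lower c m 2≤c 2≤m = begin
  m                                                ≤⟨ m≤mc ⟩
  m * c                                            ≤⟨ chebyshev-lower (m * c) (≤-trans 2≤m m≤mc) ⟩
  3 * (suc ⌊log₂ (m * c) ⌋ * primesBelow (suc (m * c)))
                                                   ≡⟨ cong (λ k → 3 * (suc ⌊log₂ (m * c) ⌋ * k)) (primesBelow-suc-composite (product-not-prime m c 2≤m 2≤c)) ⟩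
  3 * (suc ⌊log₂ (m * c) ⌋ * primesBelow (m * c))  ≤⟨ *-monoʳ-≤ 3 (*-mono-≤ (log₂-*-≤ m c 2≤m) (primesBelow≤c*S c m)) ⟩
  3 * ((⌊log₂ c ⌋ + 4) * ⌊log₂ m ⌋ * (c * S c m))  ≡⟨ reorder (⌊log₂ c ⌋ + 4) ⌊log₂ m ⌋ c (S c m) ⟩
  3 * (⌊log₂ c ⌋ + 4) * c * (S c m * ⌊log₂ m ⌋)    ∎
  where
  open ≤-Reasoning
  m≤mc : m ≤ m * c
  m≤mc = m≤m*n m c {{>-nonZero (≤-trans (n≤1+n 1) 2≤c)}}
  reorder : ∀ a l c s → 3 * (a * l * (c * s)) ≡ 3 * a * c * (s * l)
  reorder = solve-∀

-- Theorem 4: both parts hold from m = 2 on, with a = 3 (⌊log₂ c⌋ + 4) c and b = 10 c.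
theorem4 : (c : ℕ) → 3 ≤ c →
    (∃[ M ] ∀ m → M ≤ m →
        primeCount (m * c) ≤ c * S c m × S c m < primeCount (m * c))
    × (∃[ a ] ∃[ b ] ∃[ M ] ∀ m → M ≤ m →
        m ≤ a * (S c m * ⌊log₂ m ⌋) × S c m * ⌊log₂ m ⌋ ≤ b * m)
theorem4 c 3≤c =
    (2 , λ m 2≤m → block-bounds c m 3≤c 2≤m)
  , (3 * (⌊log₂ c ⌋ + 4) * c , 10 * c , 2 ,
       λ m 2≤m → S-log-lower c m 2≤c 2≤m , S-log-upper c m (≤-trans (s≤s z≤n) 3≤c))
  where
  2≤c : 2 ≤ c
  2≤c = ≤-trans (n≤1+n 2) 3≤c
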